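{- Let $k\ge 4$ and let $G_k=(X_k,\mathscr{M}_k)$ be the $k$-graph with $X_k=\{v_1,v_2,\dots,v_{2k-1}\}$ and $\mathscr{M}_k=\{M_i: i\in\{1,\dots,k\}\}$, where $M_i=\{v_i,v_{i+1},\dots,v_{i+k-1}\}$. Then: (1) $G_k$ is symmetric, and its only non-identity automorphism $\phi$ satisfies $\phi(v_i)=v_{2k-i}$ for every $i\in\{1,\dots,2k-1\}$; (2) the only automorphism $\phi$ of $G_k$ with $\{\phi(v_{2k-2}),\phi(v_{2k-1})\}=\{v_{2k-2},v_{2k-1}\}$ is the identity; (3) every non-trivial sub-$k$-graph of $G_k$ containing the vertices $v_{2k-2}$ and $v_{2k-1}$ has an involution $\phi$ with $\{\phi(v_{2k-2}),\phi(v_{2k-1})\}=\{v_{2k-2},v_{2k-1}\}$; (4) every non-trivial sub-$k$-graph of $G_k$ with at least two vertices has an involution.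
   Context: A $k$-graph is a pair $(X,\mathscr{M})$ with $X$ finite and $\mathscr{M}\subseteq\binom{X}{k}$; an automorphism is a bijection $\phi:X\to X$ with $\{\phi(M):M\in\mathscr{M}\}=\mathscr{M}$; symmetric means there is a non-identity automorphism. An involution is a non-identity automorphism $\phi$ with $\phi\circ\phi$ equal to the identity. A sub-$k$-graph of $(X,\mathscr{M})$ is $(X',\mathscr{M}')$ with $X'\subseteq X$, $\mathscr{M}'\subseteq\mathscr{M}$ (each edge of $\mathscr{M}'$ contained in $X'$); it is non-trivial if $1<|X'|<|X|$. -}

module Defs where

open import Data.Bool using (Bool; true; false; _∧_)
open import Data.Nat using (ℕ; _+_; _*_; _∸_; _<_; _≤ᵇ_; _<ᵇ_)
open import Data.Fin using (Fin; toℕ)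
open import Data.Fin.Subset using (Subset; _∈_; _⊆_; ∣_∣; ⊤)
open import Data.Fin.Subset.Properties using (_∈?_)
open import Data.Vec using (lookup; tabulate)
open import Data.Product using (Σ; ∃; _×_; _,_; proj₁)
open import Data.Sum using (_⊎_)
open import Function.Bundles using (_↔_; Inverse)
open import Relation.Nullary using (¬_; yes; no)
open import Relation.Binary.PropositionalEquality using (_≡_; _≢_)

record HGraph (n : ℕ) : Set₁ where
  field
    verts : Subset n
    edges : Subset n → Set
open HGraph public

IsKGraph : ∀ {n} → ℕ → HGraph n → Set
IsKGraph k H = ∀ M → edges H M → (M ⊆ verts H) × (∣ M ∣ ≡ k)

Vtx : ∀ {n} → HGraph n → Set
Vtx {n} H = Σ (Fin n) (λ v → v ∈ verts H)

-- Image φ(M) of a set M ⊆ X under a bijection φ of X, computed through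
-- its inverse ψ = φ⁻¹:  y ∈ φ(M)  iff  y ∈ X and φ⁻¹(y) ∈ M.
imageAt : ∀ {n} (H : HGraph n) → (Vtx H → Vtx H) → Subset n → Fin n → Bool
imageAt H ψ M y with y ∈? verts H
... | yes p = lookup M (proj₁ (ψ (y , p)))
... | no _  = false

image : ∀ {n} (H : HGraph n) → (Vtx H ↔ Vtx H) → Subset n → Subset n
image H φ M = tabulate (imageAt H (Inverse.from φ) M)

record Automorphism {n} (H : HGraph n) : Set where
  field
    bij  : Vtx H ↔ Vtx H
    into : ∀ M → edges H M → edges H (image H bij M)
    onto : ∀ M′ → edges H M′ → ∃ λ M → edges H M × (image H bij M ≡ M′)

  φ : Vtx H → Vtx H
  φ = Inverse.to bij
open Automorphism public

IsIdentity : ∀ {n} {H : HGraph n} → Automorphism H → Set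
IsIdentity a = ∀ v → φ a v ≡ v

NonIdentity : ∀ {n} {H : HGraph n} → Automorphism H → Set
NonIdentity a = ∃ λ v → φ a v ≢ v

Symmetric : ∀ {n} → HGraph n → Set
Symmetric H = ∃ λ (a : Automorphism H) → NonIdentity a

IsInvolution : ∀ {n} {H : HGraph n} → Automorphism H → Set
IsInvolution a = NonIdentity a × (∀ v → φ a (φ a v) ≡ v)

FixesPair : ∀ {n} {H : HGraph n} → Automorphism H → Vtx H → Vtx H → Set
FixesPair f a b = (φ f a ≡ a × φ f b ≡ b) ⊎ (φ f a ≡ b × φ f b ≡ a)

record SubKGraph {n} (H′ H : HGraph n) : Set where
  field
    verts⊆ : verts H′ ⊆ verts H
    edges⊆ : ∀ M → edges H′ M → edges H M
    edgesIn : ∀ M → edges H′ M → M ⊆ verts H′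

NonTrivialSub : ∀ {n} (H′ H : HGraph n) → Set
NonTrivialSub H′ H = SubKGraph H′ H × (1 < ∣ verts H′ ∣) × (∣ verts H′ ∣ < ∣ verts H ∣)

-- Vertices v_1,…,v_{2k-1} are Fin (2k-1), with v_i
-- represented by the element of Fin (2k-1) whose toℕ is i-1.
-- Edge M_i (i = 1,…,k) is represented by i-1 : Fin k and contains v_j
-- iff i ≤ j ≤ i+k-1, i.e. (i-1) ≤ (j-1) < (i-1)+k.

N : ℕ → ℕ
N k = 2 * k ∸ 1

Medge : (k : ℕ) → Fin k → Subset (N k)
Medge k i = tabulate (λ v → (toℕ i ≤ᵇ toℕ v) ∧ (toℕ v <ᵇ toℕ i + k))

G : (k : ℕ) → HGraph (N k)
G k = record { verts = ⊤ ; edges = λ S → ∃ λ (i : Fin k) → S ≡ Medge k i }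

{-# OPTIONS --safe #-}
-- Number the vertices 0,…,2K (K = k-1), so that M_{i+1} is the interval [i, i+K] and all edges meet at
-- the centre K. Put u ⊑ v when every edge through u passes through v: this is the union of the chains
-- 0 ⊑ 1 ⊑ … ⊑ K and 2K ⊑ 2K-1 ⊑ … ⊑ K, graded by the distance to the centre. An automorphism preserves ⊑
-- and is injective, hence preserves strict chains and so the distance to the centre; since 0 ⊑ v for all
-- v ≤ K, it is then the identity or the reflection v ↦ 2K - v according to where it sends 0.
-- The end edges M_1 and M_k cover every vertex, so a proper sub-k-graph omits one of them; then two
-- neighbouring vertices at the centre lie in every edge, and transposing these twins is an involution
-- fixing the far vertices v_{2k-2}, v_{2k-1}. If one of the twins is missing there are no edges at all,
-- and any transposition (in particular of v_{2k-2} and v_{2k-1}) is an involution.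
module Submission where

open import Defs
open import Data.Nat using (ℕ; _≤_; _∸_; _*_)
open import Data.Fin using (toℕ)
open import Data.Fin.Subset using (∣_∣)
open import Data.Product using (Σ; ∃; _×_; proj₁)
open import Relation.Binary.PropositionalEquality using (_≡_)

open import Data.Bool using (true; false; _∧_)
open import Data.Bool.Properties using (T-≡; T-∧; ⇔→≡)
open import Data.Empty using (⊥; ⊥-elim)
open import Data.Fin using (Fin; zero; suc; fromℕ; fromℕ<; opposite)
open import Data.Fin.Properties
  using (toℕ-injective; toℕ-fromℕ; toℕ-fromℕ<; toℕ<n; opposite-prop; opposite-involutive)
  renaming (_≟_ to _≟ᶠ_)
open import Data.Fin.Subset using (Subset; _∈_; _∉_; _⊆_; ⊤; inside; outside)
open import Data.Fin.Subset.Properties using (_∈?_; _⊆?_; ∈⊤; p⊆q⇒∣p∣≤∣q∣)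
open import Data.Nat using (zero; suc; pred; >-nonZero; z<s; _+_; _<_; z≤n; s≤s; _≤?_; _<?_; ∣_-_∣; _≤ᵇ_; _<ᵇ_)
open import Data.Nat.Properties
open import Data.Product using (_,_; proj₂; ∃₂)
open import Data.Sum using (_⊎_; inj₁; inj₂)
open import Data.Vec using (_∷_; lookup; here; there)
open import Data.Vec.Properties using (lookup∘tabulate; tabulate-cong; tabulate∘lookup; lookup⇒[]=)
open import Data.Vec.Properties.WithK using ([]=-irrelevant)
open import Function using (_∘_; _⇔_; mk⇔; Equivalence; Injection)
open import Function.Bundles using (_↔_; Inverse; mk↔ₛ′)
open import Function.Properties.Inverse using (↔⇒↣)
open import Relation.Binary using (tri<; tri≈; tri>)
open import Relation.Binary.PropositionalEquality
  using (_≢_; refl; sym; trans; cong; subst; subst₂; _≗_; ≢-sym; module ≡-Reasoning)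
open import Relation.Nullary using (¬_; yes; no; contradiction)

module RankPreservation {A : Set} (_≺_ : A → A → Set) (rank : A → ℕ) (top : ℕ)
  (rank-mono : ∀ {x y} → x ≺ y → rank x < rank y)
  (rank≤top : ∀ x → rank x ≤ top)
  (step-down : ∀ x {m} → rank x ≡ suc m → ∃ λ y → y ≺ x × rank y ≡ m)
  (step-up : ∀ x → rank x < top → ∃ λ y → x ≺ y × rank y ≡ suc (rank x))
  (g : A → A) (g-mono : ∀ {x y} → x ≺ y → g x ≺ g y)
  where

  rank≤rank∘g : ∀ m x → rank x ≡ m → m ≤ rank (g x)
  rank≤rank∘g zero    x _  = z≤n
  rank≤rank∘g (suc m) x eq with step-down x eq
  ... | y , y≺x , ry≡m = ≤-trans (s≤s (rank≤rank∘g m y ry≡m)) (rank-mono (g-mono y≺x))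

  rank∘g≤rank : ∀ d x → top ≤ d + rank x → rank (g x) ≤ rank x
  rank∘g≤rank zero    x top≤ = ≤-trans (rank≤top (g x)) top≤
  rank∘g≤rank (suc d) x top≤ with rank x <? top
  ... | no  r≮top = ≤-trans (rank≤top (g x)) (≮⇒≥ r≮top)
  ... | yes r<top with step-up x r<top
  ...   | y , x≺y , ry≡ = ≤-pred (begin-strict
          rank (g x)   <⟨ rank-mono (g-mono x≺y) ⟩
          rank (g y)   ≤⟨ rank∘g≤rank d y (subst (λ r → top ≤ d + r) (sym ry≡) top≤′) ⟩
          rank y       ≡⟨ ry≡ ⟩
          suc (rank x) ∎)
    where
    open ≤-Reasoning
    top≤′ : top ≤ d + suc (rank x)
    top≤′ = subst (top ≤_) (sym (+-suc d (rank x))) top≤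

  rank∘g≡rank : ∀ x → rank (g x) ≡ rank x
  rank∘g≡rank x = ≤-antisym (rank∘g≤rank top x (m≤m+n top (rank x))) (rank≤rank∘g (rank x) x refl)

Vtx-≡ : ∀ {n} {H : HGraph n} {u v : Vtx H} → proj₁ u ≡ proj₁ v → u ≡ v
Vtx-≡ {u = x , p} {.x , q} refl = cong (x ,_) ([]=-irrelevant p q)

φ-injective : ∀ {n} {H : HGraph n} (f : Automorphism H) {u v : Vtx H} → φ f u ≡ φ f v → u ≡ v
φ-injective f = Injection.injective (↔⇒↣ (bij f))

lookup-outside : ∀ {n} {M S : Subset n} {y} → M ⊆ S → y ∉ S → lookup M y ≡ false
lookup-outside {M = M} {y = y} M⊆S y∉S with lookup M y in eq
... | false = refl
... | true  = contradiction (M⊆S (lookup⇒[]= y M eq)) y∉S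

module _ {n} (H : HGraph n) (b : Vtx H ↔ Vtx H) where

  open Inverse b

  image-≡ : ∀ {M M′ : Subset n} →
    (∀ y (p : y ∈ verts H) → lookup M (proj₁ (from (y , p))) ≡ lookup M′ y) →
    (∀ y → y ∉ verts H → lookup M′ y ≡ false) →
    image H b M ≡ M′
  image-≡ {M} {M′} inX outX = trans (tabulate-cong pointwise) (tabulate∘lookup M′)
    where
    pointwise : imageAt H from M ≗ lookup M′
    pointwise y with y ∈? verts H
    ... | yes p = inX y p
    ... | no ¬p = sym (outX y ¬p)

  lookup-image-to : ∀ M u → lookup (image H b M) (proj₁ (to u)) ≡ lookup M (proj₁ u)
  lookup-image-to M u = trans (lookup∘tabulate _ (proj₁ (to u))) imageAt-to
    where
    imageAt-to : imageAt H from M (proj₁ (to u)) ≡ lookup M (proj₁ u)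
    imageAt-to with proj₁ (to u) ∈? verts H
    ... | yes p = cong (lookup M ∘ proj₁) (trans (cong from (Vtx-≡ {H = H} refl)) (strictlyInverseʳ u))
    ... | no ¬p = contradiction (proj₂ (to u)) ¬p

Dominated : ∀ {n} → HGraph n → Fin n → Fin n → Set
Dominated H u v = ∀ M → edges H M → lookup M u ≡ true → lookup M v ≡ true

φ-Dominated : ∀ {n} {H : HGraph n} (f : Automorphism H) {u v : Vtx H} →
  Dominated H (proj₁ u) (proj₁ v) → Dominated H (proj₁ (φ f u)) (proj₁ (φ f v))
φ-Dominated {H = H} f {u} {v} u≼v M′ e u∈ with onto f M′ e
... | M , eM , refl = trans (lookup-image-to H (bij f) M v)
                        (u≼v M eM (trans (sym (lookup-image-to H (bij f) M u)) u∈))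

Twins : ∀ {n} → HGraph n → Fin n → Fin n → Set
Twins H x y = ∀ M → edges H M → lookup M x ≡ lookup M y

Universal : ∀ {n} → HGraph n → Fin n → Set
Universal H x = ∀ M → edges H M → lookup M x ≡ true

Edgeless : ∀ {n} → HGraph n → Set
Edgeless H = ∀ M → ¬ edges H M

universal-∈⊎edgeless : ∀ {n} {H : HGraph n} {x} → (∀ M → edges H M → M ⊆ verts H) →
  Universal H x → x ∈ verts H ⊎ Edgeless H
universal-∈⊎edgeless {H = H} {x} edgesIn x∈edges with x ∈? verts H
... | yes x∈X = inj₁ x∈X
... | no  x∉X = inj₂ λ M e → x∉X (edgesIn M e (lookup⇒[]= x M (x∈edges M e)))

member : ∀ {n} (S : Subset n) → 0 < ∣ S ∣ → ∃ λ x → x ∈ S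
member (inside  ∷ S) _ = zero , here
member (outside ∷ S) h with member S h
... | x , x∈S = suc x , there x∈S

two-members : ∀ {n} (S : Subset n) → 1 < ∣ S ∣ → ∃₂ λ x y → x ∈ S × y ∈ S × x ≢ y
two-members (inside ∷ S) h with member S (≤-pred h)
... | y , y∈S = zero , suc y , here , there y∈S , λ ()
two-members (outside ∷ S) h with two-members S h
... | x , y , x∈S , y∈S , x≢y = suc x , suc y , there x∈S , there y∈S , x≢y ∘ Data.Fin.Properties.suc-injective

module Transposition {n} (H : HGraph n) (edgesIn : ∀ M → edges H M → M ⊆ verts H)
  (x y : Vtx H) (x≢y : proj₁ x ≢ proj₁ y) (twins : Twins H (proj₁ x) (proj₁ y)) where

  swap : Vtx H → Vtx H
  swap z with proj₁ z ≟ᶠ proj₁ x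
  ... | yes _ = y
  ... | no  _ with proj₁ z ≟ᶠ proj₁ y
  ...   | yes _ = x
  ...   | no  _ = z

  swap-x : swap x ≡ y
  swap-x with proj₁ x ≟ᶠ proj₁ x
  ... | yes _   = refl
  ... | no  x≢x = contradiction refl x≢x

  swap-y : swap y ≡ x
  swap-y with proj₁ y ≟ᶠ proj₁ x
  ... | yes y≡x = contradiction (sym y≡x) x≢y
  ... | no  _ with proj₁ y ≟ᶠ proj₁ y
  ...   | yes _   = refl
  ...   | no  y≢y = contradiction refl y≢y

  swap-fixes : ∀ z → proj₁ z ≢ proj₁ x → proj₁ z ≢ proj₁ y → swap z ≡ z
  swap-fixes z z≢x z≢y with proj₁ z ≟ᶠ proj₁ x
  ... | yes z≡x = contradiction z≡x z≢x
  ... | no  _ with proj₁ z ≟ᶠ proj₁ y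
  ...   | yes z≡y = contradiction z≡y z≢y
  ...   | no  _   = refl

  swap-involutive : ∀ z → swap (swap z) ≡ z
  swap-involutive z with proj₁ z ≟ᶠ proj₁ x
  ... | yes z≡x = trans swap-y (Vtx-≡ {H = H} (sym z≡x))
  ... | no  z≢x with proj₁ z ≟ᶠ proj₁ y
  ...   | yes z≡y = trans swap-x (Vtx-≡ {H = H} (sym z≡y))
  ...   | no  z≢y = swap-fixes z z≢x z≢y

  lookup-swap : ∀ M → edges H M → ∀ z → lookup M (proj₁ (swap z)) ≡ lookup M (proj₁ z)
  lookup-swap M e z with proj₁ z ≟ᶠ proj₁ x
  ... | yes refl = sym (twins M e)
  ... | no  _ with proj₁ z ≟ᶠ proj₁ y
  ...   | yes refl = twins M e
  ...   | no  _    = refl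

  swap-↔ : Vtx H ↔ Vtx H
  swap-↔ = mk↔ₛ′ swap swap swap-involutive swap-involutive

  image-swap : ∀ M → edges H M → image H swap-↔ M ≡ M
  image-swap M e = image-≡ H swap-↔ (λ y p → lookup-swap M e (y , p)) (λ _ → lookup-outside (edgesIn M e))

  transposition : Automorphism H
  transposition = record
    { bij  = swap-↔
    ; into = λ M e → subst (edges H) (sym (image-swap M e)) e
    ; onto = λ M e → M , e , image-swap M e
    }

  transposition-involution : IsInvolution transposition
  transposition-involution = (x , x≢y ∘ sym ∘ cong proj₁ ∘ trans (sym swap-x)) , swap-involutive

module Positions (K : ℕ) where

  infix 4 _⊑_ _⊏_

  _⊑_ : ℕ → ℕ → Set
  u ⊑ v = (u ≤ v × v ≤ K) ⊎ (K ≤ v × v ≤ u)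

  _⊏_ : ℕ → ℕ → Set
  u ⊏ v = u ⊑ v × u ≢ v

  InEdge : ℕ → ℕ → Set
  InEdge i v = i ≤ v × v ≤ i + K

  ⊑-InEdge : ∀ {u v i} → u ⊑ v → i ≤ K → InEdge i u → InEdge i v
  ⊑-InEdge {i = i} (inj₁ (u≤v , v≤K)) _   (i≤u , _)     = ≤-trans i≤u u≤v , ≤-trans v≤K (m≤n+m K i)
  ⊑-InEdge         (inj₂ (K≤v , v≤u)) i≤K (_ , u≤i+K) = ≤-trans i≤K K≤v , ≤-trans v≤u u≤i+K

  InEdge-⊑ : ∀ {u v} → u ≤ K + K → (∀ i → i ≤ K → InEdge i u → InEdge i v) → u ⊑ v
  InEdge-⊑ {u} {v} u≤2K h with u ≤? K
  ... | yes u≤K = inj₁ (proj₁ (h u u≤K (≤-refl , m≤m+n u K)) , proj₂ (h 0 z≤n (z≤n , u≤K)))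
  ... | no  u≰K = inj₂ (proj₁ (h K ≤-refl (K≤u , u≤2K)) , subst (v ≤_) (m∸n+n≡m K≤u) v≤u∸K+K)
    where
    K≤u : K ≤ u
    K≤u = <⇒≤ (≰⇒> u≰K)
    u∸K≤K : u ∸ K ≤ K
    u∸K≤K = subst (u ∸ K ≤_) (m+n∸n≡m K K) (∸-monoˡ-≤ K u≤2K)
    v≤u∸K+K : v ≤ u ∸ K + K
    v≤u∸K+K = proj₂ (h (u ∸ K) u∸K≤K (m∸n≤m u K , ≤-reflexive (sym (m∸n+n≡m K≤u))))

  0⊑⇒≤K : ∀ {v} → 0 ⊑ v → v ≤ K
  0⊑⇒≤K (inj₁ (_ , v≤K)) = v≤K
  0⊑⇒≤K (inj₂ (_ , z≤n)) = z≤n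

  dist : ℕ → ℕ
  dist v = ∣ v - K ∣

  dist-left : ∀ {v} → v ≤ K → dist v ≡ K ∸ v
  dist-left = m≤n⇒∣m-n∣≡n∸m

  dist-right : ∀ {v} → K ≤ v → dist v ≡ v ∸ K
  dist-right = m≤n⇒∣n-m∣≡n∸m

  dist≤K : ∀ {v} → v ≤ K + K → dist v ≤ K
  dist≤K {v} v≤2K with ≤-total v K
  ... | inj₁ v≤K = subst (_≤ K) (sym (dist-left v≤K)) (m∸n≤m K v)
  ... | inj₂ K≤v = subst₂ _≤_ (sym (dist-right K≤v)) (m+n∸n≡m K K) (∸-monoˡ-≤ K v≤2K)

  dist-⊏ : ∀ {u v} → u ⊏ v → dist v < dist u
  dist-⊏ (inj₁ (u≤v , v≤K) , u≢v) =
    subst₂ _<_ (sym (dist-left v≤K)) (sym (dist-left (≤-trans u≤v v≤K))) (∸-monoʳ-< (≤∧≢⇒< u≤v u≢v) v≤K)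
  dist-⊏ (inj₂ (K≤v , v≤u) , u≢v) =
    subst₂ _<_ (sym (dist-right K≤v)) (sym (dist-right (≤-trans K≤v v≤u))) (∸-monoˡ-< (≤∧≢⇒< v≤u (≢-sym u≢v)) K≤v)

  dist-injectiveˡ : ∀ {u v} → u ≤ K → v ≤ K → dist u ≡ dist v → u ≡ v
  dist-injectiveˡ u≤K v≤K eq = ∸-cancelˡ-≡ u≤K v≤K (trans (sym (dist-left u≤K)) (trans eq (dist-left v≤K)))

  dist-injectiveʳ : ∀ {u v} → K ≤ u → K ≤ v → dist u ≡ dist v → u ≡ v
  dist-injectiveʳ K≤u K≤v eq = ∸-cancelʳ-≡ K≤u K≤v (trans (sym (dist-right K≤u)) (trans eq (dist-right K≤v)))

  step-inwardˡ : ∀ {u} → u < K → u ⊏ suc u × suc (dist (suc u)) ≡ dist u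
  step-inwardˡ {u} u<K = (inj₁ (n≤1+n u , u<K) , ≢-sym 1+n≢n) , (begin
    suc (dist (suc u)) ≡⟨ cong suc (dist-left u<K) ⟩
    suc (K ∸ suc u)    ≡⟨ sym (+-∸-assoc 1 u<K) ⟩
    K ∸ u              ≡⟨ sym (dist-left (<⇒≤ u<K)) ⟩
    dist u             ∎)
    where open ≡-Reasoning

  step-inwardʳ : ∀ {u} → K ≤ u → suc u ⊏ u × suc (dist u) ≡ dist (suc u)
  step-inwardʳ {u} K≤u = (inj₂ (K≤u , n≤1+n u) , 1+n≢n) , (begin
    suc (dist u)  ≡⟨ cong suc (dist-right K≤u) ⟩
    suc (u ∸ K)   ≡⟨ sym (+-∸-assoc 1 K≤u) ⟩
    suc u ∸ K     ≡⟨ sym (dist-right (m≤n⇒m≤1+n K≤u)) ⟩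
    dist (suc u)  ∎)
    where open ≡-Reasoning

  step-inward : ∀ u {m} → u ≤ K + K → dist u ≡ suc m → ∃ λ v → v ≤ K + K × u ⊏ v × dist v ≡ m
  step-inward u u≤2K eq with <-cmp u K
  step-inward u u≤2K eq | tri< u<K _ _ =
    suc u , ≤-trans u<K (m≤m+n K K) , proj₁ (step-inwardˡ u<K) , suc-injective (trans (proj₂ (step-inwardˡ u<K)) eq)
  step-inward u u≤2K eq | tri≈ _ refl _ =
    contradiction (trans (sym eq) (∣n-n∣≡0 K)) λ ()
  step-inward (suc u) u≤2K eq | tri> _ _ (s≤s K≤u) =
    u , ≤-trans (n≤1+n u) u≤2K , proj₁ (step-inwardʳ K≤u) , suc-injective (trans (proj₂ (step-inwardʳ K≤u)) eq)

  step-outward : ∀ u → u ≤ K + K → dist u < K → ∃ λ v → v ≤ K + K × v ⊏ u × dist v ≡ suc (dist u)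
  step-outward u u≤2K d<K with ≤-total u K
  step-outward zero u≤2K d<K | inj₁ _ =
    contradiction (subst (_< K) (dist-left z≤n) d<K) (<-irrefl refl)
  step-outward (suc u) u≤2K d<K | inj₁ u<K =
    u , ≤-trans (n≤1+n u) u≤2K , proj₁ (step-inwardˡ u<K) , sym (proj₂ (step-inwardˡ u<K))
  step-outward u u≤2K d<K | inj₂ K≤u =
    suc u , u<2K , proj₁ (step-inwardʳ K≤u) , sym (proj₂ (step-inwardʳ K≤u))
    where
    u<2K : u < K + K
    u<2K = subst (_< K + K) (m∸n+n≡m K≤u) (+-monoˡ-< K (subst (_< K) (dist-right K≤u) d<K))

  InEdge-mirror : ∀ {u u′ i i′} → u + u′ ≡ K + K → i + i′ ≡ K → InEdge i u → InEdge i′ u′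
  InEdge-mirror {u} {u′} {i} {i′} uu′ ii′ (i≤u , u≤i+K) = i′≤u′ , u′≤i′+K
    where
    open ≤-Reasoning
    i′≤u′ : i′ ≤ u′
    i′≤u′ = +-cancelˡ-≤ u i′ u′ (begin
      u + i′       ≤⟨ +-monoˡ-≤ i′ u≤i+K ⟩
      i + K + i′   ≡⟨ +-assoc i K i′ ⟩
      i + (K + i′) ≡⟨ cong (i +_) (+-comm K i′) ⟩
      i + (i′ + K) ≡⟨ sym (+-assoc i i′ K) ⟩
      i + i′ + K   ≡⟨ cong (_+ K) ii′ ⟩
      K + K        ≡⟨ sym uu′ ⟩
      u + u′       ∎)
    u′≤i′+K : u′ ≤ i′ + K
    u′≤i′+K = +-cancelˡ-≤ i u′ (i′ + K) (begin
      i + u′       ≤⟨ +-monoˡ-≤ u′ i≤u ⟩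
      u + u′       ≡⟨ uu′ ⟩
      K + K        ≡⟨ cong (_+ K) (sym ii′) ⟩
      i + i′ + K   ≡⟨ +-assoc i i′ K ⟩
      i + (i′ + K) ∎)

  mirror-≤K : ∀ {u w} → u + w ≡ K + K → K ≤ w → u ≤ K
  mirror-≤K {u} {w} uw K≤w = +-cancelʳ-≤ K u K (subst (u + K ≤_) uw (+-monoʳ-≤ u K≤w))

  InEdge-0⊎K : ∀ {v} → v ≤ K + K → InEdge 0 v ⊎ InEdge K v
  InEdge-0⊎K {v} v≤2K with ≤-total v K
  ... | inj₁ v≤K = inj₁ (z≤n , v≤K)
  ... | inj₂ K≤v = inj₂ (K≤v , v≤2K)

  InEdge-pred-centre : ∀ {i} → i < K → InEdge i (pred K)
  InEdge-pred-centre {i} i<K = suc[m]≤n⇒m≤pred[n] i<K , ≤-trans pred[n]≤n (m≤n+m K i)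

  InEdge-centre : ∀ {i} → i ≤ K → InEdge i K
  InEdge-centre {i} i≤K = i≤K , m≤n+m K i

  InEdge-suc-centre : ∀ {i} → 0 < i → i ≤ K → InEdge i (suc K)
  InEdge-suc-centre {suc i} _ i≤K = ≤-trans i≤K (n≤1+n K) , s≤s (m≤n+m K i)

suc[opposite+toℕ] : ∀ {m} (i : Fin m) → suc (toℕ (opposite i) + toℕ i) ≡ m
suc[opposite+toℕ] {m} i = begin
  suc (toℕ (opposite i) + toℕ i) ≡⟨ sym (+-suc (toℕ (opposite i)) (toℕ i)) ⟩
  toℕ (opposite i) + suc (toℕ i) ≡⟨ cong (_+ suc (toℕ i)) (opposite-prop i) ⟩
  m ∸ suc (toℕ i) + suc (toℕ i)  ≡⟨ m∸n+n≡m (toℕ<n i) ⟩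
  m                              ∎
  where open ≡-Reasoning

toℕ-opposite : ∀ k (v : Fin (N k)) → toℕ (opposite v) ≡ 2 * k ∸ 2 ∸ toℕ v
toℕ-opposite k v = begin
  toℕ (opposite v)                ≡⟨ opposite-prop v ⟩
  2 * k ∸ 1 ∸ suc (toℕ v)         ≡⟨ ∸-+-assoc (2 * k) 1 (suc (toℕ v)) ⟩
  2 * k ∸ (2 + toℕ v)             ≡⟨ sym (∸-+-assoc (2 * k) 2 (toℕ v)) ⟩
  2 * k ∸ 2 ∸ toℕ v               ∎
  where open ≡-Reasoning

module IntervalGraph (K : ℕ) where

  open Positions K

  Vertex : Set
  Vertex = Fin (N (suc K))

  N-suc : N (suc K) ≡ suc (K + K)
  N-suc = trans (+-suc K (K + 0)) (cong (λ m → suc (K + m)) (+-identityʳ K))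

  toℕ≤ : (v : Vertex) → toℕ v ≤ K + K
  toℕ≤ v = ≤-pred (subst (toℕ v <_) N-suc (toℕ<n v))

  vertexAt : ∀ {m} → m ≤ K + K → Vertex
  vertexAt {m} m≤2K = fromℕ< (subst (m <_) (sym N-suc) (s≤s m≤2K))

  toℕ-vertexAt : ∀ {m} (m≤2K : m ≤ K + K) → toℕ (vertexAt m≤2K) ≡ m
  toℕ-vertexAt _ = toℕ-fromℕ< _

  vertex-witness : (P : ℕ → Set) → (∃ λ m → m ≤ K + K × P m) → ∃ λ (v : Vertex) → P (toℕ v)
  vertex-witness P (m , m≤2K , pm) = vertexAt m≤2K , subst P (sym (toℕ-vertexAt m≤2K)) pm

  v₀ : Vertex
  v₀ = vertexAt z≤n

  infix 4 _≺_

  _≺_ : Vertex → Vertex → Set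
  x ≺ y = toℕ y ⊏ toℕ x

  module DistancePreservation = RankPreservation _≺_ (dist ∘ toℕ) K dist-⊏ (dist≤K ∘ toℕ≤)
    (λ x eq → vertex-witness _ (step-inward (toℕ x) (toℕ≤ x) eq))
    (λ x d<K → vertex-witness _ (step-outward (toℕ x) (toℕ≤ x) d<K))

  ∈Medge⇔InEdge : ∀ i (v : Vertex) → lookup (Medge (suc K) i) v ≡ true ⇔ InEdge (toℕ i) (toℕ v)
  ∈Medge⇔InEdge i v = mk⇔ to from
    where
    lookup≡ : lookup (Medge (suc K) i) v ≡ ((toℕ i ≤ᵇ toℕ v) ∧ (toℕ v <ᵇ toℕ i + suc K))
    lookup≡ = lookup∘tabulate _ v
    to : lookup (Medge (suc K) i) v ≡ true → InEdge (toℕ i) (toℕ v)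
    to eq with Equivalence.to T-∧ (Equivalence.from T-≡ (trans (sym lookup≡) eq))
    ... | i≤v , v< = ≤ᵇ⇒≤ _ _ i≤v , ≤-pred (subst (suc (toℕ v) ≤_) (+-suc (toℕ i) K) (<ᵇ⇒< _ _ v<))
    from : InEdge (toℕ i) (toℕ v) → lookup (Medge (suc K) i) v ≡ true
    from (i≤v , v≤) = trans lookup≡ (Equivalence.to T-≡ (Equivalence.from T-∧
      (≤⇒≤ᵇ i≤v , <⇒<ᵇ (subst (suc (toℕ v) ≤_) (sym (+-suc (toℕ i) K)) (s≤s v≤)))))

  ⊑⇒Dominated : ∀ {u v : Vertex} → toℕ u ⊑ toℕ v → Dominated (G (suc K)) u v
  ⊑⇒Dominated {u} {v} u⊑v M (i , refl) u∈M = Equivalence.from (∈Medge⇔InEdge i v)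
    (⊑-InEdge u⊑v (≤-pred (toℕ<n i)) (Equivalence.to (∈Medge⇔InEdge i u) u∈M))

  Dominated⇒⊑ : ∀ {u v : Vertex} → Dominated (G (suc K)) u v → toℕ u ⊑ toℕ v
  Dominated⇒⊑ {u} {v} u≼v = InEdge-⊑ (toℕ≤ u) λ i i≤K u∈ →
    subst (λ t → InEdge t (toℕ v)) (toℕ-fromℕ< (s≤s i≤K)) (transport (fromℕ< (s≤s i≤K))
      (subst (λ t → InEdge t (toℕ u)) (sym (toℕ-fromℕ< (s≤s i≤K))) u∈))
    where
    transport : ∀ j → InEdge (toℕ j) (toℕ u) → InEdge (toℕ j) (toℕ v)
    transport j = Equivalence.to (∈Medge⇔InEdge j v) ∘ u≼v (Medge (suc K) j) (j , refl) ∘ Equivalence.from (∈Medge⇔InEdge j u)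

  vtx : Vertex → Vtx (G (suc K))
  vtx v = v , ∈⊤

  ⟦_⟧ : Automorphism (G (suc K)) → Vertex → Vertex
  ⟦ f ⟧ v = proj₁ (φ f (vtx v))

  φ≡⟦⟧ : ∀ f (v : Vtx (G (suc K))) → proj₁ (φ f v) ≡ ⟦ f ⟧ (proj₁ v)
  φ≡⟦⟧ f v = cong (proj₁ ∘ φ f) (Vtx-≡ {H = G (suc K)} refl)

  ⟦⟧-injective : ∀ f {u v} → ⟦ f ⟧ u ≡ ⟦ f ⟧ v → u ≡ v
  ⟦⟧-injective f eq = cong proj₁ (φ-injective f (Vtx-≡ {H = G (suc K)} eq))

  ⟦⟧-⊑ : ∀ f {u v : Vertex} → toℕ u ⊑ toℕ v → toℕ (⟦ f ⟧ u) ⊑ toℕ (⟦ f ⟧ v)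
  ⟦⟧-⊑ f = Dominated⇒⊑ ∘ φ-Dominated f ∘ ⊑⇒Dominated

  module ⊑-Embedding (g : Vertex → Vertex) (g-injective : ∀ {u v} → g u ≡ g v → u ≡ v)
    (g-⊑ : ∀ {u v} → toℕ u ⊑ toℕ v → toℕ (g u) ⊑ toℕ (g v)) where

    g-≺ : ∀ {x y} → x ≺ y → g x ≺ g y
    g-≺ (y⊑x , y≢x) = g-⊑ y⊑x , y≢x ∘ cong toℕ ∘ g-injective ∘ toℕ-injective

    dist-g : ∀ v → dist (toℕ (g v)) ≡ dist (toℕ v)
    dist-g = DistancePreservation.rank∘g≡rank g g-≺

    fixes-below-centre : toℕ (g v₀) ≤ K → ∀ v → toℕ v ≤ K → g v ≡ v
    fixes-below-centre g₀≤K v v≤K = toℕ-injective (dist-injectiveˡ gv≤K v≤K (dist-g v))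
      where
      -- g 0 = 0 and 0 ⊑ v keep g v below the centre, where the distance determines the position.
      g₀≡0 : toℕ (g v₀) ≡ 0
      g₀≡0 = dist-injectiveˡ g₀≤K z≤n (trans (dist-g v₀) (cong dist (toℕ-vertexAt z≤n)))
      gv≤K : toℕ (g v) ≤ K
      gv≤K = 0⊑⇒≤K (subst (_⊑ toℕ (g v)) g₀≡0
               (g-⊑ (subst (_⊑ toℕ v) (sym (toℕ-vertexAt z≤n)) (inj₁ (z≤n , v≤K)))))

    fixes-all : toℕ (g v₀) ≤ K → ∀ v → g v ≡ v
    fixes-all g₀≤K v with toℕ (g v) ≤? K | toℕ v ≤? K
    -- If g v lies below the centre it is fixed, so injectivity gives g v = v.
    ... | yes gv≤K | _       = g-injective (fixes-below-centre g₀≤K (g v) gv≤K)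
    ... | no  _    | yes v≤K = fixes-below-centre g₀≤K v v≤K
    ... | no  gv≰K | no  v≰K =
      toℕ-injective (dist-injectiveʳ (<⇒≤ (≰⇒> gv≰K)) (<⇒≤ (≰⇒> v≰K)) (dist-g v))

  opposite+toℕ : (v : Vertex) → toℕ (opposite v) + toℕ v ≡ K + K
  opposite+toℕ v = suc-injective (trans (suc[opposite+toℕ] v) N-suc)

  mirror : Vtx (G (suc K)) → Vtx (G (suc K))
  mirror (v , _) = vtx (opposite v)

  mirror-involutive : ∀ x → mirror (mirror x) ≡ x
  mirror-involutive x = Vtx-≡ {H = G (suc K)} (opposite-involutive (proj₁ x))

  mirror-↔ : Vtx (G (suc K)) ↔ Vtx (G (suc K))
  mirror-↔ = mk↔ₛ′ mirror mirror mirror-involutive mirror-involutive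

  image-mirror : ∀ i → image (G (suc K)) mirror-↔ (Medge (suc K) i) ≡ Medge (suc K) (opposite i)
  image-mirror i = image-≡ (G (suc K)) mirror-↔ (λ y _ → ⇔→≡ (mirrored y)) (λ _ y∉⊤ → contradiction ∈⊤ y∉⊤)
    where
    i+i′ : toℕ (opposite i) + toℕ i ≡ K
    i+i′ = suc-injective (suc[opposite+toℕ] i)
    mirrored : ∀ y → lookup (Medge (suc K) i) (opposite y) ≡ true ⇔ lookup (Medge (suc K) (opposite i)) y ≡ true
    mirrored y = mk⇔
      (Equivalence.from (∈Medge⇔InEdge (opposite i) y)
        ∘ InEdge-mirror (opposite+toℕ y) (trans (+-comm (toℕ i) _) i+i′)
        ∘ Equivalence.to (∈Medge⇔InEdge i (opposite y)))
      (Equivalence.from (∈Medge⇔InEdge i (opposite y))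
        ∘ InEdge-mirror (trans (+-comm (toℕ y) _) (opposite+toℕ y)) i+i′
        ∘ Equivalence.to (∈Medge⇔InEdge (opposite i) y))

  reflection : Automorphism (G (suc K))
  reflection = record
    { bij  = mirror-↔
    ; into = λ { _ (i , refl) → opposite i , image-mirror i }
    ; onto = λ { _ (j , refl) → Medge (suc K) (opposite j) , (opposite j , refl) ,
                   trans (image-mirror (opposite j)) (cong (Medge (suc K)) (opposite-involutive j)) }
    }

  classification : ∀ f → (∀ v → ⟦ f ⟧ v ≡ v) ⊎ (∀ v → ⟦ f ⟧ v ≡ opposite v)
  classification f with toℕ (⟦ f ⟧ v₀) ≤? K
  ... | yes g₀≤K = inj₁ (⊑-Embedding.fixes-all ⟦ f ⟧ (⟦⟧-injective f) (⟦⟧-⊑ f) g₀≤K)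
  ... | no  g₀≰K = inj₂ λ v → trans (sym (opposite-involutive (⟦ f ⟧ v))) (cong opposite (reflected-identity v))
    where
    reflected-identity : ∀ v → opposite (⟦ f ⟧ v) ≡ v
    reflected-identity = ⊑-Embedding.fixes-all (opposite ∘ ⟦ f ⟧)
      (⟦⟧-injective f ∘ ⟦⟧-injective reflection) (⟦⟧-⊑ reflection ∘ ⟦⟧-⊑ f)
      (mirror-≤K (opposite+toℕ (⟦ f ⟧ v₀)) (<⇒≤ (≰⇒> g₀≰K)))

  reflection-moves-v₀ : 0 < K → NonIdentity reflection
  reflection-moves-v₀ 0<K = vtx v₀ , λ fixed → <⇒≢ (+-mono-< 0<K 0<K) (sym (begin
    K + K                             ≡⟨ sym (opposite+toℕ v₀) ⟩
    toℕ (opposite v₀) + toℕ v₀        ≡⟨ cong (λ w → toℕ (proj₁ w) + toℕ v₀) fixed ⟩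
    toℕ v₀ + toℕ v₀                   ≡⟨ cong (λ t → t + t) (toℕ-vertexAt z≤n) ⟩
    0                                 ∎))
    where open ≡-Reasoning

  nonidentity-reflects : ∀ f → NonIdentity f → ∀ v → ⟦ f ⟧ v ≡ opposite v
  nonidentity-reflects f (w , φw≢w) with classification f
  ... | inj₁ fixes = contradiction (Vtx-≡ {H = G (suc K)} (trans (φ≡⟦⟧ f w) (fixes (proj₁ w)))) φw≢w
  ... | inj₂ reflects = reflects

  rigid-on-last-pair : ∀ f (a b : Vtx (G (suc K))) → 0 < toℕ (proj₁ a) →
    toℕ (proj₁ b) ≡ 2 * suc K ∸ 2 → 0 < toℕ (proj₁ b) → FixesPair f a b → IsIdentity f
  rigid-on-last-pair f a b 0<a eb 0<b fixes-ab with classification f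
  ... | inj₁ fixes = λ v → Vtx-≡ {H = G (suc K)} (trans (φ≡⟦⟧ f v) (fixes (proj₁ v)))
  ... | inj₂ reflects = ⊥-elim (impossible fixes-ab)
    where
    φb≡0 : toℕ (proj₁ (φ f b)) ≡ 0
    φb≡0 = begin
      toℕ (proj₁ (φ f b))                   ≡⟨ cong toℕ (trans (φ≡⟦⟧ f b) (reflects (proj₁ b))) ⟩
      toℕ (opposite (proj₁ b))              ≡⟨ toℕ-opposite (suc K) (proj₁ b) ⟩
      2 * suc K ∸ 2 ∸ toℕ (proj₁ b)         ≡⟨ cong (2 * suc K ∸ 2 ∸_) eb ⟩
      2 * suc K ∸ 2 ∸ (2 * suc K ∸ 2)       ≡⟨ n∸n≡0 (2 * suc K ∸ 2) ⟩
      0                                     ∎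
      where open ≡-Reasoning
    impossible : FixesPair f a b → ⊥
    impossible (inj₁ (_ , φb≡b)) = <⇒≢ 0<b (trans (sym φb≡0) (cong (toℕ ∘ proj₁) φb≡b))
    impossible (inj₂ (_ , φb≡a)) = <⇒≢ 0<a (trans (sym φb≡0) (cong (toℕ ∘ proj₁) φb≡a))

  record CentralTwins (H : HGraph (N (suc K))) : Set where
    field
      x y      : Vtx H
      distinct : proj₁ x ≢ proj₁ y
      twins    : Twins H (proj₁ x) (proj₁ y)
      x-near   : toℕ (proj₁ x) ≤ suc K
      y-near   : toℕ (proj₁ y) ≤ suc K

  toℕ≤K : (i : Fin (suc K)) → toℕ i ≤ K
  toℕ≤K i = ≤-pred (toℕ<n i)

  Medge-cover : ∀ {S : Subset (N (suc K))} → Medge (suc K) zero ⊆ S → Medge (suc K) (fromℕ K) ⊆ S → ⊤ ⊆ S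
  Medge-cover first⊆S last⊆S {y} _ with InEdge-0⊎K (toℕ≤ y)
  ... | inj₁ y∈first = first⊆S (lookup⇒[]= y _ (Equivalence.from (∈Medge⇔InEdge zero y) y∈first))
  ... | inj₂ y∈last  = last⊆S (lookup⇒[]= y _ (Equivalence.from (∈Medge⇔InEdge (fromℕ K) y)
                         (subst (λ t → InEdge t (toℕ y)) (sym (toℕ-fromℕ K)) y∈last)))

  module _ {H : HGraph (N (suc K))} (sub : SubKGraph H (G (suc K))) where

    universal-at : ∀ {m} (m≤2K : m ≤ K + K) →
      (∀ i → Medge (suc K) i ⊆ verts H → InEdge (toℕ i) m) → Universal H (vertexAt m≤2K)
    universal-at {m} m≤2K m∈ M e with SubKGraph.edges⊆ sub M e
    ... | i , refl = Equivalence.from (∈Medge⇔InEdge i (vertexAt m≤2K))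
                       (subst (InEdge (toℕ i)) (sym (toℕ-vertexAt m≤2K)) (m∈ i (SubKGraph.edgesIn sub _ e)))

    twins-or-edgeless : ∀ {x y : Vertex} → x ≢ y → toℕ x ≤ suc K → toℕ y ≤ suc K →
      Universal H x → Universal H y → CentralTwins H ⊎ Edgeless H
    twins-or-edgeless x≢y x-near y-near ux uy
      with universal-∈⊎edgeless (SubKGraph.edgesIn sub) ux | universal-∈⊎edgeless (SubKGraph.edgesIn sub) uy
    ... | inj₁ x∈X  | inj₁ y∈X  = inj₁ (record
          { x = _ , x∈X ; y = _ , y∈X ; distinct = x≢y ; twins = λ M e → trans (ux M e) (sym (uy M e))
          ; x-near = x-near ; y-near = y-near })
    ... | inj₂ none | _         = inj₂ none
    ... | inj₁ _    | inj₂ none = inj₂ none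

    universal-pair : ∀ {m m′} (m≤2K : m ≤ K + K) (m′≤2K : m′ ≤ K + K) → m ≢ m′ → m ≤ suc K → m′ ≤ suc K →
      (∀ i → Medge (suc K) i ⊆ verts H → InEdge (toℕ i) m × InEdge (toℕ i) m′) → CentralTwins H ⊎ Edgeless H
    universal-pair m≤2K m′≤2K m≢m′ m-near m′-near both = twins-or-edgeless
      (λ x≡y → m≢m′ (trans (sym (toℕ-vertexAt m≤2K)) (trans (cong toℕ x≡y) (toℕ-vertexAt m′≤2K))))
      (subst (_≤ suc K) (sym (toℕ-vertexAt m≤2K)) m-near) (subst (_≤ suc K) (sym (toℕ-vertexAt m′≤2K)) m′-near)
      (universal-at m≤2K (λ i i⊆X → proj₁ (both i i⊆X))) (universal-at m′≤2K (λ i i⊆X → proj₂ (both i i⊆X)))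

  central-twins : ∀ {H : HGraph (N (suc K))} → 0 < K → NonTrivialSub H (G (suc K)) → CentralTwins H ⊎ Edgeless H
  -- If M_k fits into X then M_1 does not, and every edge contains K and K+1; otherwise none is M_k and
  -- every edge contains K-1 and K.
  central-twins {H} 0<K (sub , _ , proper) with Medge (suc K) (fromℕ K) ⊆? verts H
  ... | yes last⊆X = universal-pair sub (m≤m+n K K) K<2K (≢-sym 1+n≢n) (n≤1+n K) ≤-refl λ i i⊆X →
        InEdge-centre (toℕ≤K i) , InEdge-suc-centre (n≢0⇒n>0 (not-first i i⊆X)) (toℕ≤K i)
    where
    K<2K : suc K ≤ K + K
    K<2K = subst (_≤ K + K) (+-comm K 1) (+-monoʳ-≤ K 0<K)
    not-first : ∀ i → Medge (suc K) i ⊆ verts H → toℕ i ≢ 0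
    not-first i i⊆X i≡0 = <⇒≱ proper (p⊆q⇒∣p∣≤∣q∣ (Medge-cover
      (subst (λ j → Medge (suc K) j ⊆ verts H) (toℕ-injective i≡0) i⊆X) last⊆X))
  ... | no last⊈X = universal-pair sub (≤-trans pred[n]≤n (m≤m+n K K)) (m≤m+n K K) (<⇒≢ pred-centre<centre)
        (≤-trans pred[n]≤n (n≤1+n K)) (n≤1+n K) λ i i⊆X →
        InEdge-pred-centre (not-last i i⊆X) , InEdge-centre (toℕ≤K i)
    where
    pred-centre<centre : pred K < K
    pred-centre<centre = subst (pred K <_) (suc-pred K {{>-nonZero 0<K}}) ≤-refl
    not-last : ∀ i → Medge (suc K) i ⊆ verts H → toℕ i < K
    not-last i i⊆X = ≤∧≢⇒< (toℕ≤K i) λ i≡K →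
      last⊈X (subst (λ j → Medge (suc K) j ⊆ verts H) (toℕ-injective (trans i≡K (sym (toℕ-fromℕ K)))) i⊆X)

  involution-fixing : ∀ {H : HGraph (N (suc K))} → 0 < K → NonTrivialSub H (G (suc K)) → ∀ (a b : Vtx H) →
    proj₁ a ≢ proj₁ b → suc K < toℕ (proj₁ a) → suc K < toℕ (proj₁ b) →
    ∃ λ (f : Automorphism H) → IsInvolution f × FixesPair f a b
  involution-fixing {H} 0<K nt a b a≢b a-far b-far with central-twins 0<K nt
  ... | inj₁ t = T.transposition , T.transposition-involution ,
        inj₁ (T.swap-fixes a (apart a x a-far x-near) (apart a y a-far y-near) ,
              T.swap-fixes b (apart b x b-far x-near) (apart b y b-far y-near))
    where
    open CentralTwins t
    module T = Transposition H (SubKGraph.edgesIn (proj₁ nt)) x y distinct twins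
    apart : ∀ (z w : Vtx H) → suc K < toℕ (proj₁ z) → toℕ (proj₁ w) ≤ suc K → proj₁ z ≢ proj₁ w
    apart _ _ z-far w-near z≡w = <⇒≱ z-far (subst (_≤ suc K) (cong toℕ (sym z≡w)) w-near)
  ... | inj₂ none = T.transposition , T.transposition-involution , inj₂ (T.swap-x , T.swap-y)
    where
    module T = Transposition H (SubKGraph.edgesIn (proj₁ nt)) a b a≢b (λ M e → ⊥-elim (none M e))

  involution : ∀ {H : HGraph (N (suc K))} → 0 < K → NonTrivialSub H (G (suc K)) →
    ∃ λ (f : Automorphism H) → IsInvolution f
  involution {H} 0<K nt with central-twins 0<K nt
  ... | inj₁ t = T.transposition , T.transposition-involution
    where
    open CentralTwins t
    module T = Transposition H (SubKGraph.edgesIn (proj₁ nt)) x y distinct twins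
  ... | inj₂ none with two-members (verts H) (proj₁ (proj₂ nt))
  ...   | x , y , x∈X , y∈X , x≢y = T.transposition , T.transposition-involution
    where
    module T = Transposition H (SubKGraph.edgesIn (proj₁ nt)) (x , x∈X) (y , y∈X) x≢y (λ M e → ⊥-elim (none M e))

lemma11 : (k : ℕ) → 4 ≤ k →
    -- (1)
    (Symmetric (G k)
      × (∀ (f : Automorphism (G k)) → NonIdentity f →
           ∀ v → toℕ (proj₁ (φ f v)) ≡ 2 * k ∸ 2 ∸ toℕ (proj₁ v)))
    -- (2)
    × (∀ (f : Automorphism (G k)) (a b : Vtx (G k)) →
         toℕ (proj₁ a) ≡ 2 * k ∸ 3 → toℕ (proj₁ b) ≡ 2 * k ∸ 2 →
         FixesPair f a b → IsIdentity f)
    -- (3)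
    × (∀ (H : HGraph (N k)) → NonTrivialSub H (G k) → ∀ (a b : Vtx H) →
         toℕ (proj₁ a) ≡ 2 * k ∸ 3 → toℕ (proj₁ b) ≡ 2 * k ∸ 2 →
         ∃ λ (f : Automorphism H) → IsInvolution f × FixesPair f a b)
    -- (4)
    × (∀ (H : HGraph (N k)) → NonTrivialSub H (G k) → 2 ≤ ∣ verts H ∣ →
         ∃ λ (f : Automorphism H) → IsInvolution f)
lemma11 (suc K@(suc (suc (suc L)))) (s≤s (s≤s (s≤s (s≤s _)))) =
    ((reflection , reflection-moves-v₀ 0<K) , λ f nonid v →
      trans (cong toℕ (trans (φ≡⟦⟧ f v) (nonidentity-reflects f nonid (proj₁ v)))) (toℕ-opposite (suc K) (proj₁ v)))
  , (λ f a b ea eb → rigid-on-last-pair f a b (subst (0 <_) (sym ea) z<s) eb (subst (0 <_) (sym eb) z<s))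
  , (λ H nt a b ea eb → involution-fixing 0<K nt a b
       (λ a≡b → 1+n≢n (trans (sym eb) (trans (cong toℕ (sym a≡b)) ea)))
       (subst (suc K <_) (sym ea) k<2k∸3) (subst (suc K <_) (sym eb) (m<n⇒m<1+n k<2k∸3)))
  , (λ H nt _ → involution 0<K nt)  -- the size bound is already part of NonTrivialSub
  where
  open IntervalGraph K
  0<K : 0 < K
  0<K = z<s
  -- 2 * suc K ∸ 3 normalises to suc (L + (4 + (L + 0))).
  k<2k∸3 : suc K < 2 * suc K ∸ 3
  k<2k∸3 = s≤s (subst (_≤ L + (4 + (L + 0))) (cong (4 +_) (+-identityʳ L)) (m≤n+m (4 + (L + 0)) L))
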